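{- Let $C$ be a binary linear code in $H(m,2)$ with minimum distance $\delta$ satisfying $3\le\delta<m$, such that the weight-$\delta$ codewords of $C$ form a $2$-$(m,\delta,\lambda)$ design $\mathcal D$, and let $C^\perp$ be the dual code of $C$, with minimum distance $\delta^\perp$. (In particular, the design hypothesis is satisfied if there exists $X\le\mathrm{Aut}(C)$ such that $X_{\mathbf 0}$ acts $2$-homogeneously on $M$.) Then $m-1\le(\delta-1)(\delta^\perp-1)$. Furthermore, if $C$ is self-orthogonal, that is $C\subseteq C^\perp$, then $\delta\ge\sqrt{m-1}+1$.
   Context: $H(m,2)$ has vertex set $\mathbb{F}_2^M$, $|M|=m$; a binary linear code is an $\mathbb{F}_2$-subspace; weight of a vector is the size of its support; $C^\perp=\{\beta:\sum_i\alpha_i\beta_i=0\ \forall\alpha\in C\}$. The weight-$\delta$ codewords form a $2$-$(m,\delta,\lambda)$ design if, viewing each as the characteristic vector of a $\delta$-subset of $M$, every $2$-subset of $M$ lies in exactly $\lambda$ of these subsets. $\mathrm{Aut}(C)$ is the setwise stabiliser of $C$ in the automorphism group of the Hamming graph, $X_{\mathbf 0}$ the stabiliser of the zero vector, acting on $M$. -}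

module Defs where

open import Data.Bool using (Bool; true; false; _∧_; _xor_; if_then_else_)
open import Data.Nat using (ℕ; zero; suc; _+_; _≡ᵇ_; _≤_)
open import Data.Fin using (Fin)
open import Data.Vec using (Vec; []; _∷_; lookup; zipWith; replicate; foldr)
open import Data.List using (List; []; _∷_; _++_; map)
open import Data.Product using (Σ; ∃; _×_; _,_)
open import Relation.Nullary using (¬_; does)
open import Relation.Unary using (Pred; Decidable)
open import Level using (0ℓ)
open import Relation.Binary.PropositionalEquality using (_≡_; _≢_)

-- Vertices of H(m,2): binary words of length m, i.e. elements of F₂^M, M = Fin m.
Word : ℕ → Set
Word m = Vec Bool m

_⊕_ : ∀ {m} → Word m → Word m → Word m
_⊕_ = zipWith _xor_

𝟎 : ∀ {m} → Word m
𝟎 = replicate _ false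

weight : ∀ {m} → Word m → ℕ
weight = foldr _ (λ b n → if b then suc n else n) 0

dist : ∀ {m} → Word m → Word m → ℕ
dist α β = weight (α ⊕ β)

inner : ∀ {m} → Word m → Word m → Bool
inner α β = foldr _ _xor_ false (zipWith _∧_ α β)

-- A binary linear code: an F₂-subspace of F₂^m
-- (over F₂, closure under 0 and + is closure under all linear combinations).
record IsLinearCode {m} (C : Pred (Word m) 0ℓ) : Set where
  field
    zero∈ : C 𝟎
    ⊕-closed : ∀ {α β} → C α → C β → C (α ⊕ β)

IsMinDist : ∀ {m} → Pred (Word m) 0ℓ → ℕ → Set
IsMinDist C δ =
  (Σ _ λ α → Σ _ λ β → C α × C β × α ≢ β × dist α β ≡ δ)
  × (∀ α β → C α → C β → α ≢ β → δ ≤ dist α β)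

Dual : ∀ {m} → Pred (Word m) 0ℓ → Pred (Word m) 0ℓ
Dual C β = ∀ α → C α → inner α β ≡ false

SelfOrthogonal : ∀ {m} → Pred (Word m) 0ℓ → Set
SelfOrthogonal C = ∀ α → C α → Dual C α

allWords : (m : ℕ) → List (Word m)
allWords zero = [] ∷ []
allWords (suc m) = map (false ∷_) (allWords m) ++ map (true ∷_) (allWords m)

countᵇ : ∀ {A : Set} → (A → Bool) → List A → ℕ
countᵇ p [] = 0
countᵇ p (x ∷ xs) = if p x then suc (countᵇ p xs) else countᵇ p xs

blocksThrough : ∀ {m} {C : Pred (Word m) 0ℓ} → Decidable C → ℕ → Fin m → Fin m → ℕ
blocksThrough {m} C? δ i j =
  countᵇ (λ v → does (C? v) ∧ (weight v ≡ᵇ δ) ∧ lookup v i ∧ lookup v j) (allWords m)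

Is2Design : ∀ {m} {C : Pred (Word m) 0ℓ} → Decidable C → ℕ → ℕ → Set
Is2Design {m} C? δ λ′ = ∀ (i j : Fin m) → i ≢ j → blocksThrough C? δ i j ≡ λ′

-- Fix a point i in the support of a minimum-weight word b of C⊥, and let r be the number of
-- blocks through i.  Counting incidences between the blocks through i and the points of a word
-- U ∋ i gives  Σ_{B ∋ i} |B ∩ U| + λ = r + λ|U|.  For U = 𝟏 this reads r(δ − 1) = λ(m − 1).
-- For U = b, each block B is a codeword, so |B ∩ b| ≡ ⟨B, b⟩ = 0 (mod 2); as i ∈ B ∩ b, the
-- intersection has at least two points, whence 2r + λ ≤ r + λδ⊥, i.e. r ≤ λ(δ⊥ − 1).
-- Together, λ(m − 1) ≤ λ(δ − 1)(δ⊥ − 1), and λ ≥ 1 since δ ≥ 2.  If C ⊆ C⊥, a nonzero word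
-- of C lies in C⊥, so δ⊥ ≤ δ.
module Submission where

open import Defs
open import Data.Nat using (ℕ; _≤_; _<_; _∸_; _*_)
open import Data.Product using (_×_)
open import Relation.Unary using (Pred; Decidable)
open import Level using (0ℓ)

open import Algebra.Bundles using (CommutativeRing)
import Algebra.Properties.CommutativeSemigroup as CommSemigroupProperties
open import Data.Bool using (Bool; true; false; T; _∧_; _xor_)
open import Data.Bool.Properties
  using (T-∧; ∧-assoc; ∧-idem; ∧-identityʳ; ∧-zeroʳ; ∧-distribˡ-xor; xor-identityʳ; xor-∧-commutativeRing)
open import Data.Empty using (⊥-elim)
open import Data.Fin using (Fin; zero; suc)
import Data.Fin.Properties as Fin
open import Data.List using (List; []; _∷_; map)
open import Data.List.Membership.Propositional using (_∈_)
open import Data.List.Membership.Propositional.Properties using (∈-map⁺; ∈-++⁺ˡ; ∈-++⁺ʳ)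
open import Data.List.Relation.Unary.Any using (here; there)
open import Data.Nat using (zero; suc; _+_; _≡ᵇ_; z≤n; s≤s; >-nonZero)
open import Data.Nat.ListAction using (sum)
open import Data.Nat.Properties
open import Data.Product using (Σ; ∃; ∃₂; _,_; proj₁; proj₂)
open import Data.Vec using ([]; _∷_; lookup; zipWith; replicate; foldr)
open import Data.Vec.Properties using (lookup-zipWith; lookup-replicate; zipWith-identityʳ)
open import Algebra.Properties.Semiring.Sum +-*-semiring
  using (sum-syntax; sum-cong-≗; sum-replicate-zero; ∑-distrib-+; *-distribˡ-sum)
  renaming (sum to ∑)
open import Function using (_∘_; Equivalence)
open import Relation.Nullary using (does; yes; no)
open import Relation.Binary.PropositionalEquality

⟦_⟧ : Bool → ℕ
⟦ true ⟧ = 1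
⟦ false ⟧ = 0

⟦∧⟧ : ∀ a b → ⟦ a ∧ b ⟧ ≡ ⟦ a ⟧ * ⟦ b ⟧
⟦∧⟧ true b = sym (+-identityʳ ⟦ b ⟧)
⟦∧⟧ false b = refl

T⇒⟦⟧≡1 : ∀ {b} → T b → ⟦ b ⟧ ≡ 1
T⇒⟦⟧≡1 {true} _ = refl

∑-agreeing-off : ∀ {m} (i : Fin m) (f g : Fin m → ℕ) → (∀ j → j ≢ i → f j ≡ g j) →
  ∑[ j < m ] f j + g i ≡ f i + ∑[ j < m ] g j
∑-agreeing-off zero f g f≗g = begin
  f zero + ∑ (f ∘ suc) + g zero   ≡⟨ cong (λ s → f zero + s + g zero) (sum-cong-≗ (λ j → f≗g (suc j) λ ())) ⟩
  f zero + ∑ (g ∘ suc) + g zero   ≡⟨ xy∙z≈x∙zy (f zero) _ _ ⟩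
  f zero + (g zero + ∑ (g ∘ suc)) ∎
  where
  open CommSemigroupProperties +-commutativeSemigroup
  open ≡-Reasoning
∑-agreeing-off (suc i) f g f≗g = begin
  f zero + ∑ (f ∘ suc) + g (suc i)   ≡⟨ +-assoc (f zero) _ _ ⟩
  f zero + (∑ (f ∘ suc) + g (suc i)) ≡⟨ cong (f zero +_) (∑-agreeing-off i _ _ λ j j≢i → f≗g (suc j) (j≢i ∘ Fin.suc-injective)) ⟩
  f zero + (f (suc i) + ∑ (g ∘ suc)) ≡⟨ x∙yz≈y∙xz (f zero) (f (suc i)) (∑ (g ∘ suc)) ⟩
  f (suc i) + (f zero + ∑ (g ∘ suc)) ≡⟨ cong (λ x → f (suc i) + (x + _)) (f≗g zero λ ()) ⟩
  f (suc i) + (g zero + ∑ (g ∘ suc)) ∎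
  where
  open CommSemigroupProperties +-commutativeSemigroup
  open ≡-Reasoning

∣_∩_∣ : ∀ {m} → Word m → Word m → ℕ
∣ u ∩ v ∣ = weight (zipWith _∧_ u v)

weight-∑ : ∀ {m} (v : Word m) → weight v ≡ ∑[ j < m ] ⟦ lookup v j ⟧
weight-∑ [] = refl
weight-∑ (true ∷ v) = cong suc (weight-∑ v)
weight-∑ (false ∷ v) = weight-∑ v

∣∩∣-∑ : ∀ {m} (u v : Word m) → ∣ u ∩ v ∣ ≡ ∑[ j < m ] (⟦ lookup u j ⟧ * ⟦ lookup v j ⟧)
∣∩∣-∑ u v = trans (weight-∑ (zipWith _∧_ u v))
  (sum-cong-≗ λ j → trans (cong ⟦_⟧ (lookup-zipWith _∧_ j u v)) (⟦∧⟧ (lookup u j) (lookup v j)))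

∣∩𝟏∣ : ∀ {m} (v : Word m) → ∣ v ∩ replicate m true ∣ ≡ weight v
∣∩𝟏∣ v = cong weight (zipWith-identityʳ ∧-identityʳ v)

weight-𝟏 : ∀ m → weight (replicate m true) ≡ m
weight-𝟏 zero = refl
weight-𝟏 (suc m) = cong suc (weight-𝟏 m)

T-lookup⇒1≤weight : ∀ {m} (v : Word m) i → T (lookup v i) → 1 ≤ weight v
T-lookup⇒1≤weight (true ∷ v) zero _ = s≤s z≤n
T-lookup⇒1≤weight (true ∷ v) (suc i) _ = s≤s z≤n
T-lookup⇒1≤weight (false ∷ v) (suc i) t = T-lookup⇒1≤weight v i t

support-suc : ∀ {m} {a} {w : Word m} → ∃ (λ i → T (lookup w i)) → ∃ (λ i → T (lookup (a ∷ w) i))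
support-suc (i , t) = suc i , t

1≤weight⇒support : ∀ {m} (v : Word m) → 1 ≤ weight v → ∃ λ i → T (lookup v i)
1≤weight⇒support (true ∷ v) _ = zero , _
1≤weight⇒support (false ∷ v) 1≤w = support-suc (1≤weight⇒support v 1≤w)

2≤weight⇒support : ∀ {m} (v : Word m) → 2 ≤ weight v →
  ∃₂ λ i j → i ≢ j × T (lookup v i) × T (lookup v j)
2≤weight⇒support (true ∷ v) (s≤s 1≤w) with 1≤weight⇒support v 1≤w
... | j , t = zero , suc j , (λ ()) , _ , t
2≤weight⇒support (false ∷ v) 2≤w with 2≤weight⇒support v 2≤w
... | i , j , i≢j , tᵢ , tⱼ = suc i , suc j , i≢j ∘ Fin.suc-injective , tᵢ , tⱼ

countᵇ-∷ : ∀ {A : Set} (p : A → Bool) x xs → countᵇ p (x ∷ xs) ≡ ⟦ p x ⟧ + countᵇ p xs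
countᵇ-∷ p x xs with p x
... | true = refl
... | false = refl

countᵇ-cong : ∀ {A : Set} {p q : A → Bool} → (∀ x → p x ≡ q x) → ∀ xs → countᵇ p xs ≡ countᵇ q xs
countᵇ-cong p≗q [] = refl
countᵇ-cong {p = p} {q} p≗q (x ∷ xs) = begin
  countᵇ p (x ∷ xs)        ≡⟨ countᵇ-∷ p x xs ⟩
  ⟦ p x ⟧ + countᵇ p xs    ≡⟨ cong₂ _+_ (cong ⟦_⟧ (p≗q x)) (countᵇ-cong p≗q xs) ⟩
  ⟦ q x ⟧ + countᵇ q xs    ≡⟨ countᵇ-∷ q x xs ⟨
  countᵇ q (x ∷ xs)        ∎
  where open ≡-Reasoning

∈⇒1≤countᵇ : ∀ {A : Set} (p : A → Bool) {x xs} → x ∈ xs → T (p x) → 1 ≤ countᵇ p xs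
∈⇒1≤countᵇ p {xs = y ∷ xs} (here refl) t rewrite countᵇ-∷ p y xs | T⇒⟦⟧≡1 t = s≤s z≤n
∈⇒1≤countᵇ p {xs = y ∷ xs} (there x∈xs) t rewrite countᵇ-∷ p y xs =
  ≤-trans (∈⇒1≤countᵇ p x∈xs t) (m≤n+m _ _)

sum-restricted-≡ : ∀ {A : Set} (p : A → Bool) (g : A → ℕ) c → (∀ x → T (p x) → g x ≡ c) →
  ∀ xs → sum (map (λ x → ⟦ p x ⟧ * g x) xs) ≡ countᵇ p xs * c
sum-restricted-≡ p g c g≡c [] = refl
sum-restricted-≡ p g c g≡c (x ∷ xs) = begin
  ⟦ p x ⟧ * g x + sum (map (λ x → ⟦ p x ⟧ * g x) xs) ≡⟨ cong₂ _+_ (summand (p x) (g≡c x)) (sum-restricted-≡ p g c g≡c xs) ⟩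
  ⟦ p x ⟧ * c + countᵇ p xs * c                       ≡⟨ *-distribʳ-+ c ⟦ p x ⟧ (countᵇ p xs) ⟨
  (⟦ p x ⟧ + countᵇ p xs) * c                         ≡⟨ cong (_* c) (countᵇ-∷ p x xs) ⟨
  countᵇ p (x ∷ xs) * c                               ∎
  where
  open ≡-Reasoning
  summand : ∀ b → (T b → g x ≡ c) → ⟦ b ⟧ * g x ≡ ⟦ b ⟧ * c
  summand true g≡c = cong (_+ 0) (g≡c _)
  summand false _ = refl

sum-restricted-≥ : ∀ {A : Set} (p : A → Bool) (g : A → ℕ) c → (∀ x → T (p x) → c ≤ g x) →
  ∀ xs → countᵇ p xs * c ≤ sum (map (λ x → ⟦ p x ⟧ * g x) xs)
sum-restricted-≥ p g c c≤g [] = z≤n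
sum-restricted-≥ p g c c≤g (x ∷ xs) = begin
  countᵇ p (x ∷ xs) * c                               ≡⟨ cong (_* c) (countᵇ-∷ p x xs) ⟩
  (⟦ p x ⟧ + countᵇ p xs) * c                         ≡⟨ *-distribʳ-+ c ⟦ p x ⟧ (countᵇ p xs) ⟩
  ⟦ p x ⟧ * c + countᵇ p xs * c                       ≤⟨ +-mono-≤ (summand (p x) (c≤g x)) (sum-restricted-≥ p g c c≤g xs) ⟩
  ⟦ p x ⟧ * g x + sum (map (λ x → ⟦ p x ⟧ * g x) xs) ∎
  where
  open ≤-Reasoning
  summand : ∀ b → (T b → c ≤ g x) → ⟦ b ⟧ * c ≤ ⟦ b ⟧ * g x
  summand true c≤g = +-monoˡ-≤ 0 (c≤g _)
  summand false _ = z≤n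

∑-countᵇ≡sum-∣∩∣ : ∀ {m} (p : Word m → Bool) (u : Word m) (vs : List (Word m)) →
  ∑[ j < m ] (countᵇ (λ v → p v ∧ lookup v j) vs * ⟦ lookup u j ⟧)
    ≡ sum (map (λ v → ⟦ p v ⟧ * ∣ v ∩ u ∣) vs)
∑-countᵇ≡sum-∣∩∣ {m} p u [] = sum-replicate-zero m
∑-countᵇ≡sum-∣∩∣ {m} p u (v ∷ vs) = begin
  ∑[ j < m ] (countᵇ (through j) (v ∷ vs) * ⟦ lookup u j ⟧)
    ≡⟨ sum-cong-≗ (λ j → trans (cong (_* ⟦ lookup u j ⟧) (countᵇ-∷ (through j) v vs))
                                (*-distribʳ-+ ⟦ lookup u j ⟧ ⟦ through j v ⟧ _)) ⟩
  ∑[ j < m ] (⟦ through j v ⟧ * ⟦ lookup u j ⟧ + countᵇ (through j) vs * ⟦ lookup u j ⟧)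
    ≡⟨ ∑-distrib-+ (λ j → ⟦ through j v ⟧ * ⟦ lookup u j ⟧) _ ⟩
  ∑[ j < m ] (⟦ through j v ⟧ * ⟦ lookup u j ⟧) + ∑[ j < m ] (countᵇ (through j) vs * ⟦ lookup u j ⟧)
    ≡⟨ cong₂ _+_ single-word (∑-countᵇ≡sum-∣∩∣ p u vs) ⟩
  ⟦ p v ⟧ * ∣ v ∩ u ∣ + sum (map (λ v → ⟦ p v ⟧ * ∣ v ∩ u ∣) vs) ∎
  where
  open ≡-Reasoning
  through : Fin m → Word m → Bool
  through j v = p v ∧ lookup v j
  single-word : ∑[ j < m ] (⟦ through j v ⟧ * ⟦ lookup u j ⟧) ≡ ⟦ p v ⟧ * ∣ v ∩ u ∣
  single-word = begin
    ∑[ j < m ] (⟦ through j v ⟧ * ⟦ lookup u j ⟧)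
      ≡⟨ sum-cong-≗ (λ j → trans (cong (_* ⟦ lookup u j ⟧) (⟦∧⟧ (p v) (lookup v j))) (*-assoc ⟦ p v ⟧ _ _)) ⟩
    ∑[ j < m ] (⟦ p v ⟧ * (⟦ lookup v j ⟧ * ⟦ lookup u j ⟧))
      ≡⟨ *-distribˡ-sum ⟦ p v ⟧ (λ j → ⟦ lookup v j ⟧ * ⟦ lookup u j ⟧) ⟨
    ⟦ p v ⟧ * ∑[ j < m ] (⟦ lookup v j ⟧ * ⟦ lookup u j ⟧)
      ≡⟨ cong (⟦ p v ⟧ *_) (∣∩∣-∑ v u) ⟨
    ⟦ p v ⟧ * ∣ v ∩ u ∣ ∎

allWords-complete : ∀ {m} (v : Word m) → v ∈ allWords m
allWords-complete [] = here refl
allWords-complete {suc m} (false ∷ v) = ∈-++⁺ˡ (∈-map⁺ (false ∷_) (allWords-complete v))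
allWords-complete {suc m} (true ∷ v) = ∈-++⁺ʳ (map (false ∷_) (allWords m)) (∈-map⁺ (true ∷_) (allWords-complete v))

module Design {m} {C : Pred (Word m) 0ℓ} (C? : Decidable C) (δ λ′ : ℕ) (design : Is2Design C? δ λ′) where

  isBlock : Word m → Bool
  isBlock v = does (C? v) ∧ (weight v ≡ᵇ δ)

  isBlock-sound : ∀ v → T (isBlock v) → C v × weight v ≡ δ
  isBlock-sound v t with C? v
  ... | yes v∈C = v∈C , ≡ᵇ⇒≡ (weight v) δ t

  isBlock-complete : ∀ {v} → C v → weight v ≡ δ → T (isBlock v)
  isBlock-complete {v} v∈C ∣v∣≡δ with C? v
  ... | yes _ = ≡⇒≡ᵇ (weight v) δ ∣v∣≡δ
  ... | no v∉C = ⊥-elim (v∉C v∈C)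

  1≤λ : ∀ {v} → C v → weight v ≡ δ → 2 ≤ δ → 1 ≤ λ′
  1≤λ {v} v∈C ∣v∣≡δ 2≤δ with 2≤weight⇒support v (subst (2 ≤_) (sym ∣v∣≡δ) 2≤δ)
  ... | i , j , i≢j , tᵢ , tⱼ = subst (1 ≤_) (design i j i≢j)
    (∈⇒1≤countᵇ _ (allWords-complete v)
      (subst T (∧-assoc (does (C? v)) _ _)
        (Equivalence.from T-∧ (isBlock-complete v∈C ∣v∣≡δ , Equivalence.from T-∧ (tᵢ , tⱼ)))))

  module _ (i : Fin m) where

    isBlockThrough : Word m → Bool
    isBlockThrough v = isBlock v ∧ lookup v i

    replication : ℕ
    replication = countᵇ isBlockThrough (allWords m)

    sum-∣∩∣-over-blocks : ∀ u → T (lookup u i) →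
      sum (map (λ v → ⟦ isBlockThrough v ⟧ * ∣ v ∩ u ∣) (allWords m)) + λ′ ≡ replication + λ′ * weight u
    sum-∣∩∣-over-blocks u uᵢ = begin
      sum (map (λ v → ⟦ isBlockThrough v ⟧ * ∣ v ∩ u ∣) (allWords m)) + λ′
        ≡⟨ cong (_+ λ′) (∑-countᵇ≡sum-∣∩∣ isBlockThrough u (allWords m)) ⟨
      ∑[ j < m ] (N j * ⟦ lookup u j ⟧) + λ′
        ≡⟨ cong (∑[ j < m ] (N j * ⟦ lookup u j ⟧) +_) (trans (cong (λ′ *_) (T⇒⟦⟧≡1 uᵢ)) (*-identityʳ λ′)) ⟨
      ∑[ j < m ] (N j * ⟦ lookup u j ⟧) + λ′ * ⟦ lookup u i ⟧
        ≡⟨ ∑-agreeing-off i _ _ (λ j j≢i → cong (_* ⟦ lookup u j ⟧) (N-off j j≢i)) ⟩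
      N i * ⟦ lookup u i ⟧ + ∑[ j < m ] (λ′ * ⟦ lookup u j ⟧)
        ≡⟨ cong₂ _+_ (trans (cong₂ _*_ N-at (T⇒⟦⟧≡1 uᵢ)) (*-identityʳ replication))
                     (trans (sym (*-distribˡ-sum λ′ (⟦_⟧ ∘ lookup u))) (cong (λ′ *_) (sym (weight-∑ u)))) ⟩
      replication + λ′ * weight u ∎
      where
      open ≡-Reasoning
      N : Fin m → ℕ
      N j = countᵇ (λ v → isBlockThrough v ∧ lookup v j) (allWords m)
      N-off : ∀ j → j ≢ i → N j ≡ λ′
      N-off j j≢i = trans
        (countᵇ-cong (λ v → trans (∧-assoc (isBlock v) _ _) (∧-assoc (does (C? v)) _ _)) (allWords m))
        (design i j (j≢i ∘ sym))
      N-at : N i ≡ replication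
      N-at = countᵇ-cong (λ v → trans (∧-assoc (isBlock v) _ _) (cong (isBlock v ∧_) (∧-idem (lookup v i)))) (allWords m)

    replication-identity : replication * δ + λ′ ≡ replication + λ′ * m
    replication-identity = begin
      replication * δ + λ′
        ≡⟨ cong (_+ λ′) (sum-restricted-≡ isBlockThrough (λ v → ∣ v ∩ 𝟏 ∣) δ block-size (allWords m)) ⟨
      sum (map (λ v → ⟦ isBlockThrough v ⟧ * ∣ v ∩ 𝟏 ∣) (allWords m)) + λ′
        ≡⟨ sum-∣∩∣-over-blocks 𝟏 (subst T (sym (lookup-replicate i true)) _) ⟩
      replication + λ′ * weight 𝟏
        ≡⟨ cong (λ w → replication + λ′ * w) (weight-𝟏 m) ⟩
      replication + λ′ * m ∎
      where
      open ≡-Reasoning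
      𝟏 : Word m
      𝟏 = replicate m true
      block-size : ∀ v → T (isBlockThrough v) → ∣ v ∩ 𝟏 ∣ ≡ δ
      block-size v t = trans (∣∩𝟏∣ v) (proj₂ (isBlock-sound v (proj₁ (Equivalence.to T-∧ t))))

    replication-bound : ∀ c u → T (lookup u i) → (∀ v → T (isBlockThrough v) → c ≤ ∣ v ∩ u ∣) →
      replication * c + λ′ ≤ replication + λ′ * weight u
    replication-bound c u uᵢ c≤∣v∩u∣ = ≤-trans
      (+-monoˡ-≤ λ′ (sum-restricted-≥ isBlockThrough (λ v → ∣ v ∩ u ∣) c c≤∣v∩u∣ (allWords m)))
      (≤-reflexive (sum-∣∩∣-over-blocks u uᵢ))

inner-⊕ʳ : ∀ {m} (γ x y : Word m) → inner γ (x ⊕ y) ≡ inner γ x xor inner γ y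
inner-⊕ʳ [] [] [] = refl
inner-⊕ʳ (c ∷ γ) (a ∷ x) (b ∷ y) = begin
  (c ∧ (a xor b)) xor inner γ (x ⊕ y)                ≡⟨ cong₂ _xor_ (∧-distribˡ-xor c a b) (inner-⊕ʳ γ x y) ⟩
  ((c ∧ a) xor (c ∧ b)) xor (inner γ x xor inner γ y) ≡⟨ interchange (c ∧ a) (c ∧ b) (inner γ x) (inner γ y) ⟩
  ((c ∧ a) xor inner γ x) xor ((c ∧ b) xor inner γ y) ∎
  where
  open ≡-Reasoning
  open CommSemigroupProperties (CommutativeRing.+-commutativeSemigroup xor-∧-commutativeRing)

inner-𝟎ʳ : ∀ {m} (γ : Word m) → inner γ 𝟎 ≡ false
inner-𝟎ʳ [] = refl
inner-𝟎ʳ (c ∷ γ) = cong₂ _xor_ (∧-zeroʳ c) (inner-𝟎ʳ γ)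

Dual-isLinearCode : ∀ {m} {C : Pred (Word m) 0ℓ} → IsLinearCode (Dual C)
Dual-isLinearCode = record
  { zero∈ = λ γ _ → inner-𝟎ʳ γ
  ; ⊕-closed = λ x∈C⊥ y∈C⊥ γ γ∈C → trans (inner-⊕ʳ γ _ _) (cong₂ _xor_ (x∈C⊥ γ γ∈C) (y∈C⊥ γ γ∈C))
  }

weight≡0⇒even : ∀ {m} (w : Word m) → weight w ≡ 0 → foldr (λ _ → Bool) _xor_ false w ≡ false
weight≡0⇒even [] _ = refl
weight≡0⇒even (false ∷ w) ∣w∣≡0 = weight≡0⇒even w ∣w∣≡0

weight≡1⇒odd : ∀ {m} (w : Word m) → weight w ≡ 1 → foldr (λ _ → Bool) _xor_ false w ≡ true
weight≡1⇒odd (true ∷ w) ∣w∣≡1 = cong (true xor_) (weight≡0⇒even w (suc-injective ∣w∣≡1))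
weight≡1⇒odd (false ∷ w) ∣w∣≡1 = weight≡1⇒odd w ∣w∣≡1

∣codeword∩dual∣≢1 : ∀ {m} {C : Pred (Word m) 0ℓ} {v b} → C v → Dual C b → ∣ v ∩ b ∣ ≢ 1
∣codeword∩dual∣≢1 {v = v} {b} v∈C b∈C⊥ ∣v∩b∣≡1 with trans (sym (weight≡1⇒odd (zipWith _∧_ v b) ∣v∩b∣≡1)) (b∈C⊥ v v∈C)
... | ()

2≤∣codeword∩dual∣ : ∀ {m} {C : Pred (Word m) 0ℓ} {v b} i → C v → Dual C b →
  T (lookup v i) → T (lookup b i) → 2 ≤ ∣ v ∩ b ∣
2≤∣codeword∩dual∣ {v = v} {b} i v∈C b∈C⊥ vᵢ bᵢ = ≤∧≢⇒<
  (T-lookup⇒1≤weight (zipWith _∧_ v b) i (subst T (sym (lookup-zipWith _∧_ i v b)) (Equivalence.from T-∧ (vᵢ , bᵢ))))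
  (∣codeword∩dual∣≢1 v∈C b∈C⊥ ∘ sym)

≢⇒⊕-support : ∀ {m} (α β : Word m) → α ≢ β → ∃ λ i → T (lookup (α ⊕ β) i)
≢⇒⊕-support [] [] α≢β = ⊥-elim (α≢β refl)
≢⇒⊕-support (false ∷ α) (true ∷ β) _ = zero , _
≢⇒⊕-support (true ∷ α) (false ∷ β) _ = zero , _
≢⇒⊕-support (false ∷ α) (false ∷ β) α≢β = support-suc (≢⇒⊕-support α β (α≢β ∘ cong (false ∷_)))
≢⇒⊕-support (true ∷ α) (true ∷ β) α≢β = support-suc (≢⇒⊕-support α β (α≢β ∘ cong (true ∷_)))

minimum-weight-word : ∀ {m} {C : Pred (Word m) 0ℓ} {δ} → IsLinearCode C → IsMinDist C δ →
  Σ (Word m) λ v → C v × weight v ≡ δ × ∃ (λ i → T (lookup v i))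
minimum-weight-word lin ((α , β , α∈C , β∈C , α≢β , dist≡δ) , _) =
  α ⊕ β , IsLinearCode.⊕-closed lin α∈C β∈C , dist≡δ , ≢⇒⊕-support α β α≢β

selfOrthogonal⇒δ⊥≤δ : ∀ {m} {C : Pred (Word m) 0ℓ} {δ δ⊥} → IsLinearCode C → SelfOrthogonal C →
  IsMinDist C δ → IsMinDist (Dual C) δ⊥ → δ⊥ ≤ δ
selfOrthogonal⇒δ⊥≤δ lin C⊆C⊥ minC (_ , δ⊥-min)
  with v , v∈C , ∣v∣≡δ , i , vᵢ ← minimum-weight-word lin minC =
  subst (_ ≤_) (trans (cong weight (zipWith-identityʳ xor-identityʳ v)) ∣v∣≡δ)
    (δ⊥-min v 𝟎 (C⊆C⊥ v v∈C) (IsLinearCode.zero∈ Dual-isLinearCode) v≢𝟎)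
  where
  v≢𝟎 : v ≢ 𝟎
  v≢𝟎 v≡𝟎 = subst T (lookup-replicate i false) (subst (λ w → T (lookup w i)) v≡𝟎 vᵢ)

a+b≡c+d⇒a∸c≡d∸b : ∀ a b c d → a + b ≡ c + d → a ∸ c ≡ d ∸ b
a+b≡c+d⇒a∸c≡d∸b a b c d a+b≡c+d = begin
  a ∸ c             ≡⟨ [m+n]∸[m+o]≡n∸o b a c ⟨
  b + a ∸ (b + c)   ≡⟨ cong₂ _∸_ (trans (+-comm b a) a+b≡c+d) (+-comm b c) ⟩
  c + d ∸ (c + b)   ≡⟨ [m+n]∸[m+o]≡n∸o c d b ⟩
  d ∸ b             ∎
  where open ≡-Reasoning

replication-arithmetic : ∀ {r λ′ m δ e} → 1 ≤ λ′ →
  r * δ + λ′ ≡ r + λ′ * m → r * 2 + λ′ ≤ r + λ′ * e → m ∸ 1 ≤ (δ ∸ 1) * (e ∸ 1)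
replication-arithmetic {r} {λ′} {m} {δ} {e} 1≤λ identity bound =
  *-cancelˡ-≤ λ′ {{>-nonZero 1≤λ}} (begin
    λ′ * (m ∸ 1)             ≡⟨ *-distrib-∸1 λ′ m ⟩
    λ′ * m ∸ λ′              ≡⟨ a+b≡c+d⇒a∸c≡d∸b (r * δ) λ′ r (λ′ * m) identity ⟨
    r * δ ∸ r                ≡⟨ *-distrib-∸1 r δ ⟨
    r * (δ ∸ 1)              ≤⟨ *-monoˡ-≤ (δ ∸ 1) r≤λ[e-1] ⟩
    λ′ * (e ∸ 1) * (δ ∸ 1)   ≡⟨ *-assoc λ′ (e ∸ 1) (δ ∸ 1) ⟩
    λ′ * ((e ∸ 1) * (δ ∸ 1)) ≡⟨ cong (λ′ *_) (*-comm (e ∸ 1) (δ ∸ 1)) ⟩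
    λ′ * ((δ ∸ 1) * (e ∸ 1)) ∎)
  where
  open ≤-Reasoning
  *-distrib-∸1 : ∀ x y → x * (y ∸ 1) ≡ x * y ∸ x
  *-distrib-∸1 x y = trans (*-distribˡ-∸ x y 1) (cong (x * y ∸_) (*-identityʳ x))
  r+λ≤λe : r + λ′ ≤ λ′ * e
  r+λ≤λe = +-cancelˡ-≤ r _ _ (≤-trans (≤-reflexive r+[r+λ]≡r*2+λ) bound)
    where
    r+[r+λ]≡r*2+λ : r + (r + λ′) ≡ r * 2 + λ′
    r+[r+λ]≡r*2+λ = trans (sym (+-assoc r r λ′))
      (cong (_+ λ′) (sym (trans (*-comm r 2) (cong (r +_) (+-identityʳ r)))))
  r≤λ[e-1] : r ≤ λ′ * (e ∸ 1)
  r≤λ[e-1] = subst (r ≤_) (sym (*-distrib-∸1 λ′ e)) (m+n≤o⇒m≤o∸n r r+λ≤λe)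

lemma4p4 : (m : ℕ) (C : Pred (Word m) 0ℓ) (C? : Decidable C) → IsLinearCode C →
    (δ : ℕ) → IsMinDist C δ → 3 ≤ δ → δ < m →
    (λ′ : ℕ) → Is2Design C? δ λ′ →
    (δ⊥ : ℕ) → IsMinDist (Dual C) δ⊥ →
    (m ∸ 1 ≤ (δ ∸ 1) * (δ⊥ ∸ 1))
    × (SelfOrthogonal C → m ∸ 1 ≤ (δ ∸ 1) * (δ ∸ 1))
lemma4p4 m C C? lin δ minC 3≤δ _ λ′ design δ⊥ minC⊥ =
  m-1≤[δ-1][δ⊥-1] ,
  λ C⊆C⊥ → ≤-trans m-1≤[δ-1][δ⊥-1] (*-monoʳ-≤ (δ ∸ 1) (∸-monoˡ-≤ 1 (selfOrthogonal⇒δ⊥≤δ lin C⊆C⊥ minC minC⊥)))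
  where
  open Design C? δ λ′ design
  m-1≤[δ-1][δ⊥-1] : m ∸ 1 ≤ (δ ∸ 1) * (δ⊥ ∸ 1)
  m-1≤[δ-1][δ⊥-1]
    with v , v∈C , ∣v∣≡δ , _ ← minimum-weight-word lin minC
       | b , b∈C⊥ , ∣b∣≡δ⊥ , i , bᵢ ← minimum-weight-word Dual-isLinearCode minC⊥ =
    replication-arithmetic (1≤λ v∈C ∣v∣≡δ (≤-trans (n≤1+n 2) 3≤δ)) (replication-identity i)
      (subst (λ w → _ ≤ _ + λ′ * w) ∣b∣≡δ⊥ (replication-bound i 2 b bᵢ blocks-meet-b-twice))
    where
    blocks-meet-b-twice : ∀ u → T (isBlockThrough i u) → 2 ≤ ∣ u ∩ b ∣
    blocks-meet-b-twice u t with block , uᵢ ← Equivalence.to T-∧ t =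
      2≤∣codeword∩dual∣ i (proj₁ (isBlock-sound u block)) b∈C⊥ uᵢ bᵢ
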